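{- For any positive integers $r\geq 2$ and $n_1,\dots,n_r$, the complete $r$-partite graph $K_{n_1,\dots,n_r}$ has a cyclic interval $n$-coloring, where $n=\sum_{i=1}^r n_i$.
   Context: $K_{n_1,\dots,n_r}$ is the simple graph whose vertex set is partitioned into independent sets $V_1,\dots,V_r$ with $|V_i|=n_i$, and in which every vertex of $V_i$ is adjacent to every vertex of $V_j$ for all $i\neq j$. A proper $t$-edge coloring of $G$ is a map $\alpha:E(G)\to\{1,\dots,t\}$ with $\alpha(e)\neq\alpha(e')$ for adjacent edges $e,e'$; $S(v,\alpha)$ is the set of colors on edges incident to $v$. A proper $t$-edge coloring $\alpha$ is a cyclic interval $t$-coloring if for every vertex $v$, either $S(v,\alpha)$ or $\{1,\dots,t\}\setminus S(v,\alpha)$ is a set of consecutive integers. -}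

module Defs where

open import Data.Nat using (ℕ; _≤_; _<_; suc)
open import Data.Fin using (Fin)
open import Data.Product using (Σ; ∃; ∃-syntax; _×_; _,_; proj₁; proj₂)
open import Relation.Binary.PropositionalEquality using (_≡_; _≢_)
open import Relation.Nullary using (¬_)
open import Function.Bundles using (_⇔_)
import Data.Sum

sumFin : (r : ℕ) → (Fin r → ℕ) → ℕ
sumFin Data.Nat.zero f = 0
sumFin (suc r) f = f Data.Fin.zero Data.Nat.+ sumFin r (λ i → f (Data.Fin.suc i))

Vertex : (r : ℕ) → (Fin r → ℕ) → Set
Vertex r n = Σ (Fin r) (λ i → Fin (n i))

Adj : {r : ℕ} {n : Fin r → ℕ} → Vertex r n → Vertex r n → Set
Adj u v = proj₁ u ≢ proj₁ v

-- An edge coloring with colors in ℕ, given as a function on ordered pairs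
-- of vertices; only its values on adjacent pairs matter.
record ProperEdgeColoring (r : ℕ) (n : Fin r → ℕ) (t : ℕ)
                          (α : Vertex r n → Vertex r n → ℕ) : Set where
  field
    symmetric : ∀ u v → Adj u v → α u v ≡ α v u
    inRange   : ∀ u v → Adj u v → 1 ≤ α u v × α u v ≤ t
    proper    : ∀ v u w → Adj v u → Adj v w → u ≢ w → α v u ≢ α v w

S : {r : ℕ} {n : Fin r → ℕ} → (Vertex r n → Vertex r n → ℕ) → Vertex r n → ℕ → Set
S α v k = ∃[ u ] (Adj v u × α v u ≡ k)

-- A subset P of {1,...,t} (given as a predicate, considered only on
-- 1..t) is a set of consecutive integers: it equals an interval [a,b]∩{1..t}.
-- (a > b gives the empty interval.)
Consecutive : (t : ℕ) → (ℕ → Set) → Set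
Consecutive t P = ∃[ a ] ∃[ b ] (∀ k → 1 ≤ k → k ≤ t → (P k ⇔ (a ≤ k × k ≤ b)))

-- Complement of P within {1,...,t} (membership considered on 1..t).
Compl : (ℕ → Set) → ℕ → Set
Compl P k = ¬ P k

record CyclicIntervalColoring (r : ℕ) (n : Fin r → ℕ) (t : ℕ)
                              (α : Vertex r n → Vertex r n → ℕ) : Set₁ where
  field
    isProper : ProperEdgeColoring r n t α
    cyclic   : ∀ v → Consecutive t (S α v) Data.Sum.⊎ Consecutive t (Compl (S α v))

module Submission where

-- Number the vertices 0, …, N − 1 part after part, N = n₁ + ⋯ + nᵣ, and give
-- the edge uv the colour 1 + ((index u + index v) mod N).  At a vertex v of
-- index x, the rotation q ↦ (x + q) mod N permutes ℤ/N, so the colouring is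
-- proper and the colours missing at v are the image of the block of indices
-- [o, o + m) of v's own part.  That image is an arc of ℤ/N: if it does not
-- wrap around, the missing colours form an interval; if it does, the colours
-- present at v do.

open import Defs
open import Data.Nat using (ℕ; _≤_; _<_; zero; suc; _+_; _∸_; z≤n; s≤s; s≤s⁻¹; _≤?_; _<?_)
open import Data.Nat.Properties
open import Data.Fin as Fin using (Fin; toℕ; fromℕ<)
open import Data.Fin.Properties using (toℕ-fromℕ<; toℕ-injective; toℕ<n)
open import Data.Product using (∃-syntax; _×_; _,_; proj₁; proj₂; map₁)
open import Data.Sum using (_⊎_; inj₁; inj₂)
open import Function using (_∘_)
open import Function.Bundles using (_⇔_; mk⇔; Equivalence)
open import Function.Construct.Composition using (_⇔-∘_)
open import Function.Related.TypeIsomorphisms using (¬-cong-⇔)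
open import Relation.Nullary using (¬_; Dec; yes; no; contradiction)
open import Relation.Nullary.Decidable using (_×-dec_; _⊎-dec_; decidable-stable)
open import Relation.Binary.PropositionalEquality

infix 4 _≤_<_

_≤_<_ : ℕ → ℕ → ℕ → Set
a ≤ q < b = (a ≤ q) × (q < b)

≤<-monoˡ : ∀ x {a q b} → a ≤ q < b → x + a ≤ x + q < x + b
≤<-monoˡ x (a≤q , q<b) = +-monoʳ-≤ x a≤q , +-monoʳ-< x q<b

≤<-cancelˡ : ∀ x {a q b} → x + a ≤ x + q < x + b → a ≤ q < b
≤<-cancelˡ x (a≤q , q<b) = +-cancelˡ-≤ x _ _ a≤q , +-cancelˡ-< x _ _ q<b

⇔¬⇒¬⇔ : ∀ {A B : Set} → Dec B → A ⇔ (¬ B) → (¬ A) ⇔ B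
⇔¬⇒¬⇔ B? A⇔¬B = mk⇔ (λ ¬a → decidable-stable B? (¬a ∘ Equivalence.from A⇔¬B))
                    (λ b a → Equivalence.to A⇔¬B a b)

offset : (r : ℕ) (n : Fin r → ℕ) → Fin r → ℕ
offset (suc r) n Fin.zero    = 0
offset (suc r) n (Fin.suc i) = n Fin.zero + offset r (n ∘ Fin.suc) i

index : {r : ℕ} {n : Fin r → ℕ} → Vertex r n → ℕ
index {r} {n} (i , a) = offset r n i + toℕ a

Block : (r : ℕ) (n : Fin r → ℕ) → Fin r → ℕ → Set
Block r n i q = offset r n i ≤ q < offset r n i + n i

offset+size≤sumFin : ∀ r n i → offset r n i + n i ≤ sumFin r n
offset+size≤sumFin (suc r) n Fin.zero    = m≤m+n (n Fin.zero) _
offset+size≤sumFin (suc r) n (Fin.suc i) =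
  subst (_≤ sumFin (suc r) n) (sym (+-assoc (n Fin.zero) _ _))
        (+-monoʳ-≤ (n Fin.zero) (offset+size≤sumFin r (n ∘ Fin.suc) i))

index∈Block : ∀ {r n} (u : Vertex r n) → Block r n (proj₁ u) (index u)
index∈Block {r} {n} (i , a) = m≤m+n _ _ , +-monoʳ-< (offset r n i) (toℕ<n a)

index<sumFin : ∀ {r n} (u : Vertex r n) → index u < sumFin r n
index<sumFin {r} {n} u = <-≤-trans (proj₂ (index∈Block u)) (offset+size≤sumFin r n (proj₁ u))

index∈Block⇒part≡ : ∀ r n (u : Vertex r n) i → Block r n i (index u) → proj₁ u ≡ i
index∈Block⇒part≡ (suc r) n (Fin.zero , a) Fin.zero _ = refl
index∈Block⇒part≡ (suc r) n (Fin.zero , a) (Fin.suc i) (lo , _) =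
  contradiction (toℕ<n a) (≤⇒≯ (m+n≤o⇒m≤o (n Fin.zero) lo))
index∈Block⇒part≡ (suc r) n (Fin.suc j , a) Fin.zero (_ , hi) =
  contradiction hi (≤⇒≯ (≤-trans (m≤m+n (n Fin.zero) _) (m≤m+n _ (toℕ a))))
index∈Block⇒part≡ (suc r) n (Fin.suc j , a) (Fin.suc i) (lo , hi) =
  cong Fin.suc (index∈Block⇒part≡ r (n ∘ Fin.suc) (j , a) i (≤<-cancelˡ (n Fin.zero)
    ( subst (n Fin.zero + offset r (n ∘ Fin.suc) i ≤_) (+-assoc (n Fin.zero) _ _) lo
    , subst₂ _<_ (+-assoc (n Fin.zero) _ _) (+-assoc (n Fin.zero) _ _) hi)))

index-injective : ∀ {r n} (u w : Vertex r n) → index u ≡ index w → u ≡ w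
index-injective {r} {n} (i , a) w eq
  with index∈Block⇒part≡ r n w i (subst (Block r n i) eq (index∈Block (i , a)))
... | refl = cong (i ,_) (toℕ-injective (+-cancelˡ-≡ (offset r n i) _ _ eq))

index-surjective : ∀ r n {q} → q < sumFin r n → ∃[ u ] index {r} {n} u ≡ q
index-surjective (suc r) n {q} q<N with q <? n Fin.zero
... | yes q<n₀ = (Fin.zero , fromℕ< q<n₀) , toℕ-fromℕ< q<n₀
... | no q≮n₀
  with index-surjective r (n ∘ Fin.suc)
         (subst (q ∸ n Fin.zero <_) (m+n∸m≡n (n Fin.zero) _) (∸-monoˡ-< q<N (≮⇒≥ q≮n₀)))
...   | (j , a) , eq = (Fin.suc j , a) , (begin
          n Fin.zero + offset r (n ∘ Fin.suc) j + toℕ a  ≡⟨ +-assoc (n Fin.zero) _ _ ⟩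
          n Fin.zero + index (j , a)                     ≡⟨ cong (n Fin.zero +_) eq ⟩
          n Fin.zero + (q ∸ n Fin.zero)                  ≡⟨ m+[n∸m]≡n (≮⇒≥ q≮n₀) ⟩
          q                                              ∎)
  where open ≡-Reasoning

-- Reduction modulo N, valid on [0, 2N).
wrap : ℕ → ℕ → ℕ
wrap N y with y <? N
... | yes _ = y
... | no  _ = y ∸ N

wrap-< : ∀ {N y} → y < N + N → wrap N y < N
wrap-< {N} {y} y<2N with y <? N
... | yes y<N = y<N
... | no  y≮N = subst (y ∸ N <_) (m+n∸m≡n N N) (∸-monoˡ-< y<2N (≮⇒≥ y≮N))

wrap≡⇒ : ∀ {N y d} → wrap N y ≡ d → y ≡ d ⊎ y ≡ N + d
wrap≡⇒ {N} {y} with y <? N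
... | yes _   = inj₁
... | no  y≮N = λ eq → inj₂ (trans (sym (m+[n∸m]≡n (≮⇒≥ y≮N))) (cong (N +_) eq))

⇒wrap≡ : ∀ {N y d} → d < N → y ≡ d ⊎ y ≡ N + d → wrap N y ≡ d
⇒wrap≡ {N} {d = d} d<N (inj₁ refl) with d <? N
... | yes _   = refl
... | no  d≮N = contradiction d<N d≮N
⇒wrap≡ {N} {d = d} d<N (inj₂ refl) with N + d <? N
... | yes N+d<N = contradiction N+d<N (m+n≮m N d)
... | no  _     = m+n∸m≡n N d

wrap-gap : ∀ {N x a b d} → x + a ≡ d → x + b ≡ N + d → b ≡ N + a
wrap-gap {N} {x} {a} {b} refl x+b≡N+d = +-cancelˡ-≡ x b (N + a) (begin
  x + b        ≡⟨ x+b≡N+d ⟩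
  N + (x + a)  ≡⟨ sym (+-assoc N x a) ⟩
  N + x + a    ≡⟨ cong (_+ a) (+-comm N x) ⟩
  x + N + a    ≡⟨ +-assoc x N a ⟩
  x + (N + a)  ∎)
  where open ≡-Reasoning

rotate-injective : ∀ {N x a b} → a < N → b < N → wrap N (x + a) ≡ wrap N (x + b) → a ≡ b
rotate-injective {N} {x} {a} {b} a<N b<N eq with wrap≡⇒ {N} {x + a} refl | wrap≡⇒ (sym eq)
... | inj₁ p | inj₁ q = +-cancelˡ-≡ x a b (trans p (sym q))
... | inj₂ p | inj₂ q = +-cancelˡ-≡ x a b (trans p (sym q))
... | inj₁ p | inj₂ q = contradiction b<N (≤⇒≯ (subst (N ≤_) (sym (wrap-gap p q)) (m≤m+n N a)))
... | inj₂ p | inj₁ q = contradiction a<N (≤⇒≯ (subst (N ≤_) (sym (wrap-gap q p)) (m≤m+n N b)))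

rotate-surjective : ∀ {N x d} → x < N → d < N → ∃[ q ] q < N × wrap N (x + q) ≡ d
rotate-surjective {N} {x} {d} x<N d<N with x ≤? d
... | yes x≤d = d ∸ x , ≤-<-trans (m∸n≤m d x) d<N , ⇒wrap≡ d<N (inj₁ (m+[n∸m]≡n x≤d))
... | no  x≰d = N + d ∸ x
              , subst (N + d ∸ x <_) (m+n∸n≡m N x) (∸-monoˡ-< (+-monoʳ-< N (≰⇒> x≰d)) x≤N+d)
              , ⇒wrap≡ d<N (inj₂ (m+[n∸m]≡n x≤N+d))
  where
  x≤N+d : x ≤ N + d
  x≤N+d = ≤-trans (<⇒≤ x<N) (m≤m+n N d)

-- The residue d < N is covered, modulo N, by the integers in [a, b) ⊆ [0, 2N).
Arc : ℕ → ℕ → ℕ → ℕ → Set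
Arc N a b d = (a ≤ d < b) ⊎ (a ≤ N + d < b)

Arc? : ∀ N a b d → Dec (Arc N a b d)
Arc? N a b d = (a ≤? d ×-dec d <? b) ⊎-dec (a ≤? N + d ×-dec N + d <? b)

rotate-segment : ∀ {N x a b d} → d < N →
  (∃[ q ] (a ≤ q < b) × wrap N (x + q) ≡ d) ⇔ Arc N (x + a) (x + b) d
rotate-segment {N} {x} {a} {b} {d} d<N = mk⇔ to from
  where
  to : ∃[ q ] (a ≤ q < b) × wrap N (x + q) ≡ d → Arc N (x + a) (x + b) d
  to (q , a≤q<b , eq) with wrap≡⇒ eq
  ... | inj₁ x+q≡d   = inj₁ (subst (x + a ≤_< x + b) x+q≡d   (≤<-monoˡ x a≤q<b))
  ... | inj₂ x+q≡N+d = inj₂ (subst (x + a ≤_< x + b) x+q≡N+d (≤<-monoˡ x a≤q<b))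

  unrotate : ∀ {y} → x + a ≤ y < x + b → y ≡ d ⊎ y ≡ N + d → ∃[ q ] (a ≤ q < b) × wrap N (x + q) ≡ d
  unrotate {y} x+a≤y<x+b y≡ = y ∸ x
    , ≤<-cancelˡ x (subst (x + a ≤_< x + b) (sym x+[y∸x]≡y) x+a≤y<x+b)
    , ⇒wrap≡ d<N (subst (λ z → z ≡ d ⊎ z ≡ N + d) (sym x+[y∸x]≡y) y≡)
    where
    x+[y∸x]≡y : x + (y ∸ x) ≡ y
    x+[y∸x]≡y = m+[n∸m]≡n (≤-trans (m≤m+n x a) (proj₁ x+a≤y<x+b))

  from : Arc N (x + a) (x + b) d → ∃[ q ] (a ≤ q < b) × wrap N (x + q) ≡ d
  from (inj₁ in-range) = unrotate in-range (inj₁ refl)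
  from (inj₂ in-range) = unrotate in-range (inj₂ refl)

arc-unwrapped : ∀ {N a b d} → b ≤ N → Arc N a b d ⇔ a ≤ d < b
arc-unwrapped {N} {a} {b} {d} b≤N = mk⇔ to inj₁
  where
  to : Arc N a b d → a ≤ d < b
  to (inj₁ a≤d<b)       = a≤d<b
  to (inj₂ (_ , N+d<b)) = contradiction N+d<b (≤⇒≯ (≤-trans b≤N (m≤m+n N d)))

arc-shifted : ∀ {N a b d} → d < N → Arc N (N + a) (N + b) d ⇔ a ≤ d < b
arc-shifted {N} {a} {b} {d} d<N = mk⇔ to (inj₂ ∘ ≤<-monoˡ N)
  where
  to : Arc N (N + a) (N + b) d → a ≤ d < b
  to (inj₁ (N+a≤d , _)) = contradiction d<N (≤⇒≯ (m+n≤o⇒m≤o N N+a≤d))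
  to (inj₂ in-range)     = ≤<-cancelˡ N in-range

¬arc-wrapped : ∀ {N a b d} → a < N → d < N → (¬ Arc N a (N + b) d) ⇔ b ≤ d < a
¬arc-wrapped {N} {a} {b} {d} a<N d<N = mk⇔ to from
  where
  to : ¬ Arc N a (N + b) d → b ≤ d < a
  to ¬arc = ≮⇒≥ (λ d<b → ¬arc (inj₂ (≤-trans (<⇒≤ a<N) (m≤m+n N d) , +-monoʳ-< N d<b)))
          , ≰⇒> (λ a≤d → ¬arc (inj₁ (a≤d , <-≤-trans d<N (m≤m+n N b))))
  from : b ≤ d < a → ¬ Arc N a (N + b) d
  from (_ , d<a)   (inj₁ (a≤d , _))    = <⇒≱ d<a a≤d
  from (b≤d , _)   (inj₂ (_ , N+d<N+b)) = <⇒≱ (+-cancelˡ-< N d b N+d<N+b) b≤d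

consecutive : ∀ {N} {P : ℕ → Set} a b → (∀ {d} → d < N → P (suc d) ⇔ a ≤ d < b) → Consecutive N P
consecutive a b P⇔ = suc a , b , λ
  { zero    ()
  ; (suc d) _ d<N → mk⇔ (map₁ s≤s) (map₁ s≤s⁻¹) ⇔-∘ P⇔ d<N
  }

arc-cyclic : ∀ {N a b} {P : ℕ → Set} → (∀ {d} → d < N → P (suc d) ⇔ (¬ Arc N a b d)) →
  Consecutive N P ⊎ Consecutive N (Compl P)
arc-cyclic {N} {a} {b} P⇔¬arc with b ≤? N
... | yes b≤N = inj₂ (consecutive a b λ d<N → arc-unwrapped b≤N ⇔-∘ ⇔¬⇒¬⇔ (Arc? _ _ _ _) (P⇔¬arc d<N))
... | no  b≰N with m≤n⇒∃[o]m+o≡n (<⇒≤ (≰⇒> b≰N))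
...   | b′ , refl with N ≤? a
...     | no  a≱N = inj₁ (consecutive b′ a λ d<N → ¬arc-wrapped (≰⇒> a≱N) d<N ⇔-∘ P⇔¬arc d<N)
...     | yes N≤a with m≤n⇒∃[o]m+o≡n N≤a
...       | a′ , refl = inj₂ (consecutive a′ b′ λ d<N →
                          arc-shifted d<N ⇔-∘ ⇔¬⇒¬⇔ (Arc? _ _ _ _) (P⇔¬arc d<N))

module _ (r : ℕ) (n : Fin r → ℕ) where

  private
    N : ℕ
    N = sumFin r n

  colouring : Vertex r n → Vertex r n → ℕ
  colouring u v = suc (wrap N (index u + index v))

  colouring-proper : ProperEdgeColoring r n N colouring
  colouring-proper = record
    { symmetric = λ u v _ → cong (suc ∘ wrap N) (+-comm (index u) (index v))
    ; inRange   = λ u v _ → s≤s z≤n , wrap-< (+-mono-< (index<sumFin u) (index<sumFin v))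
    ; proper    = λ v u w _ _ u≢w eq → u≢w (index-injective u w
                    (rotate-injective {x = index v} (index<sumFin u) (index<sumFin w)
                      (suc-injective eq)))
    }

  RotatedBlock : Vertex r n → ℕ → Set
  RotatedBlock v d = ∃[ q ] Block r n (proj₁ v) q × wrap N (index v + q) ≡ d

  colours⇔¬rotated-block : ∀ v {d} → d < N → S colouring v (suc d) ⇔ (¬ RotatedBlock v d)
  colours⇔¬rotated-block v {d} d<N = mk⇔ to from
    where
    to : S colouring v (suc d) → ¬ RotatedBlock v d
    to (u , v≁u , eq) (q , q∈block , eq′) = v≁u (sym (index∈Block⇒part≡ r n u (proj₁ v)
      (subst (Block r n (proj₁ v)) q≡index-u q∈block)))
      where
      q≡index-u : q ≡ index u
      q≡index-u = rotate-injective (<-≤-trans (proj₂ q∈block) (offset+size≤sumFin r n (proj₁ v)))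
                    (index<sumFin u) (trans eq′ (sym (suc-injective eq)))

    from : ¬ RotatedBlock v d → S colouring v (suc d)
    from ¬rotated with rotate-surjective (index<sumFin v) d<N
    ... | q , q<N , eq with index-surjective r n q<N
    ...   | u , refl = u , v≁u , cong suc eq
      where
      v≁u : Adj v u
      v≁u same-part =
        ¬rotated (index u , subst (λ i → Block r n i (index u)) (sym same-part) (index∈Block u) , eq)

  colouring-cyclic : ∀ v → Consecutive N (S colouring v) ⊎ Consecutive N (Compl (S colouring v))
  colouring-cyclic v =
    arc-cyclic λ d<N → ¬-cong-⇔ (rotate-segment d<N) ⇔-∘ colours⇔¬rotated-block v d<N

theorem6 : (r : ℕ) → 2 ≤ r → (n : Fin r → ℕ) → (∀ i → 1 ≤ n i) →
    ∃[ α ] CyclicIntervalColoring r n (sumFin r n) α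
theorem6 r _ n _ = colouring r n , record
  { isProper = colouring-proper r n
  ; cyclic   = colouring-cyclic r n
  }
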